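{- Let $S$ be an atomic base, $A$ a formula, $\Gamma=x_1:A_1,\dots,x_n:A_n$ a context and $t$ a term with $tFV(t)\subseteq\{x_1,\dots,x_n\}$. If the term $t$ of $A$ from $\Gamma$ is E-valid, then $t\twoheadrightarrow s$ for some normal proof-term $s$ such that $\Gamma\vdash s:A$ is derivable in $\mathbf{IL_{at}}$.
   Context: $\mathbf{IL_{at}}$: formulas $A::=X\mid A\to B\mid\forall X.A$ ($X$ an atom); terms $t::=x\mid c^A\mid\lambda x.t\mid ts\mid\Lambda X.t\mid tX$ (a term-constant $c^A$ for every formula $A$; in $tX$, $X$ is an atom), up to $\alpha$-equivalence, capture-avoiding substitution; $tFV(t)$ = free term-variables; closed = no free term-variables. Typing rules: $\Gamma,x:A\vdash x:A$; $\Gamma\vdash c^A:A$ for every $A$; $\Gamma,x:A\vdash t:B\Rightarrow\Gamma\vdash\lambda x.t:A\to B$; $\Gamma\vdash t:A\to B,\ \Gamma\vdash s:A\Rightarrow\Gamma\vdash ts:B$; $\Gamma\vdash t:A\Rightarrow\Gamma\vdash\Lambda X.t:\forall X.A$ provided $X$ not free in formulas of $\Gamma$; $\Gamma\vdash t:\forall X.A\Rightarrow\Gamma\vdash tY:A[X:=Y]$ ($Y$ an atom). $\beta$-reduction: compatible closure of $(\lambda x.t)s\to_\beta t[x:=s]$, $(\Lambda X.t)Y\to_\beta t[X:=Y]$; $\twoheadrightarrow$ its reflexive-transitive closure; normal = contains no redex. An atomic base $S$ is a set of term-constants $c^X$ for atoms $X$. A proof-term is a term containing no term-constants other than those in $S$.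 qE-validity: (1) a closed term $t$ of atom $X$ is qE-valid iff $t\twoheadrightarrow s$ for a normal $s$ with $\vdash s:X$ derivable; (2) a closed $t$ of $B\to C$ is qE-valid iff $ts$ of $C$ is qE-valid for every qE-valid closed $s$ of $B$; (3) a closed $t$ of $\forall X.A$ is qE-valid iff $tY$ of $A[X:=Y]$ is qE-valid for every atom $Y$; (4) a term $t$ of $A$ from $x_1:A_1,\dots,x_n:A_n$ with $tFV(t)\subseteq\{x_1,\dots,x_n\}$ is qE-valid iff $t[x_1:=t_1,\dots,x_n:=t_n]$ of $A$ is qE-valid for all qE-valid closed $t_i$ of $A_i$. A term is E-valid iff it is a proof-term and qE-valid. -}

module Defs where

open import Data.Nat using (ℕ; zero; suc; _<_; _≤_; _∸_)
open import Data.List using (List; []; _∷_; map; length)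
open import Data.Product using (Σ; _×_; _,_; ∃)
open import Data.Unit using (⊤)
open import Data.Empty using (⊥)
open import Relation.Binary.Construct.Closure.ReflexiveTransitive using (Star)

-- Syntax of IL_at with de Bruijn indices for both atoms and term
-- variables (so α-equivalent terms are syntactically equal).
-- Free atoms are the natural numbers; inside ∀ / Λ, index 0 is the
-- bound atom and index (suc k) is the free atom k of the outside.

infixr 7 _⇒_
data Formula : Set where
  atom : ℕ → Formula
  _⇒_  : Formula → Formula → Formula
  all  : Formula → Formula

data Term : Set where
  var  : ℕ → Term
  con  : Formula → Term
  lam  : Term → Term
  app  : Term → Term → Term
  tlam : Term → Term
  tapp : Term → ℕ → Term

ext : (ℕ → ℕ) → ℕ → ℕ
ext ρ zero    = zero
ext ρ (suc i) = suc (ρ i)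

renF : (ℕ → ℕ) → Formula → Formula
renF ρ (atom X) = atom (ρ X)
renF ρ (A ⇒ B)  = renF ρ A ⇒ renF ρ B
renF ρ (all A)  = all (renF (ext ρ) A)

-- the renaming [X:=Y] used to instantiate a ∀-body with atom Y
-- (index 0 ↦ Y, index suc i ↦ i)
inst : ℕ → ℕ → ℕ
inst Y zero    = Y
inst Y (suc i) = i

_[0≔_] : Formula → ℕ → Formula
A [0≔ Y ] = renF (inst Y) A

renTT : (ℕ → ℕ) → Term → Term
renTT ρ (var i)    = var i
renTT ρ (con A)    = con (renF ρ A)
renTT ρ (lam t)    = lam (renTT ρ t)
renTT ρ (app t s)  = app (renTT ρ t) (renTT ρ s)
renTT ρ (tlam t)   = tlam (renTT (ext ρ) t)
renTT ρ (tapp t Y) = tapp (renTT ρ t) (ρ Y)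

renT : (ℕ → ℕ) → Term → Term
renT ρ (var i)    = var (ρ i)
renT ρ (con A)    = con A
renT ρ (lam t)    = lam (renT (ext ρ) t)
renT ρ (app t s)  = app (renT ρ t) (renT ρ s)
renT ρ (tlam t)   = tlam (renT ρ t)
renT ρ (tapp t Y) = tapp (renT ρ t) Y

exts : (ℕ → Term) → ℕ → Term
exts σ zero    = var zero
exts σ (suc i) = renT suc (σ i)

extsT : (ℕ → Term) → ℕ → Term
extsT σ i = renTT suc (σ i)

sub : (ℕ → Term) → Term → Term
sub σ (var i)    = σ i
sub σ (con A)    = con A
sub σ (lam t)    = lam (sub (exts σ) t)
sub σ (app t s)  = app (sub σ t) (sub σ s)
sub σ (tlam t)   = tlam (sub (extsT σ) t)
sub σ (tapp t Y) = tapp (sub σ t) Y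

_∷σ_ : Term → (ℕ → Term) → ℕ → Term
(s ∷σ σ) zero    = s
(s ∷σ σ) (suc i) = σ i

_[x≔_] : Term → Term → Term
t [x≔ s ] = sub (s ∷σ var) t

Scoped : ℕ → Term → Set
Scoped n (var i)    = i < n
Scoped n (con A)    = ⊤
Scoped n (lam t)    = Scoped (suc n) t
Scoped n (app t s)  = Scoped n t × Scoped n s
Scoped n (tlam t)   = Scoped n t
Scoped n (tapp t Y) = Scoped n t

Closed : Term → Set
Closed = Scoped zero

-- Typing (Curry style).  Contexts are lists, head = variable index 0.

data _∋_∶_ : List Formula → ℕ → Formula → Set where
  here  : ∀ {Γ A} → (A ∷ Γ) ∋ zero ∶ A
  there : ∀ {Γ A B i} → Γ ∋ i ∶ A → (B ∷ Γ) ∋ suc i ∶ A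

infix 4 _⊢_∶_
data _⊢_∶_ : List Formula → Term → Formula → Set where
  ⊢var  : ∀ {Γ i A} → Γ ∋ i ∶ A → Γ ⊢ var i ∶ A
  ⊢con  : ∀ {Γ A} → Γ ⊢ con A ∶ A
  ⊢lam  : ∀ {Γ t A B} → (A ∷ Γ) ⊢ t ∶ B → Γ ⊢ lam t ∶ A ⇒ B
  ⊢app  : ∀ {Γ t s A B} → Γ ⊢ t ∶ A ⇒ B → Γ ⊢ s ∶ A → Γ ⊢ app t s ∶ B
  -- eigenvariable condition: X is a fresh atom (index 0) not occurring in Γ
  ⊢tlam : ∀ {Γ t A} → map (renF suc) Γ ⊢ t ∶ A → Γ ⊢ tlam t ∶ all A
  ⊢tapp : ∀ {Γ t A} (Y : ℕ) → Γ ⊢ t ∶ all A → Γ ⊢ tapp t Y ∶ A [0≔ Y ]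

infix 4 _⟶β_
data _⟶β_ : Term → Term → Set where
  β      : ∀ {t s} → app (lam t) s ⟶β t [x≔ s ]
  βT     : ∀ {t Y} → tapp (tlam t) Y ⟶β renTT (inst Y) t
  ξlam   : ∀ {t t'} → t ⟶β t' → lam t ⟶β lam t'
  ξappL  : ∀ {t t' s} → t ⟶β t' → app t s ⟶β app t' s
  ξappR  : ∀ {t s s'} → s ⟶β s' → app t s ⟶β app t s'
  ξtlam  : ∀ {t t'} → t ⟶β t' → tlam t ⟶β tlam t'
  ξtapp  : ∀ {t t' Y} → t ⟶β t' → tapp t Y ⟶β tapp t' Y

infix 4 _↠_
_↠_ : Term → Term → Set
_↠_ = Star _⟶β_

NotLam : Term → Set
NotLam (lam t) = ⊥
NotLam _       = ⊤

NotTlam : Term → Set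
NotTlam (tlam t) = ⊥
NotTlam _        = ⊤

Normal : Term → Set
Normal (var i)    = ⊤
Normal (con A)    = ⊤
Normal (lam t)    = Normal t
Normal (app t s)  = NotLam t × Normal t × Normal s
Normal (tlam t)   = Normal t
Normal (tapp t Y) = NotTlam t × Normal t

-- An atomic base: a set of atoms X, standing for the constants c^X.
AtomicBase : Set₁
AtomicBase = ℕ → Set

-- ProofTermUnder S k t : every constant in t is c^X for a free atom X
-- (i.e. de Bruijn index ≥ k, the number of enclosing Λ's) with the
-- corresponding outside atom X ∸ k in S.
ProofTermUnder : AtomicBase → ℕ → Term → Set
ProofTermUnder S k (var i)         = ⊤
ProofTermUnder S k (con (atom X))  = (k ≤ X) × S (X ∸ k)
ProofTermUnder S k (con (A ⇒ B))   = ⊥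
ProofTermUnder S k (con (all A))   = ⊥
ProofTermUnder S k (lam t)         = ProofTermUnder S k t
ProofTermUnder S k (app t s)       = ProofTermUnder S k t × ProofTermUnder S k s
ProofTermUnder S k (tlam t)        = ProofTermUnder S (suc k) t
ProofTermUnder S k (tapp t Y)      = ProofTermUnder S k t

ProofTerm : AtomicBase → Term → Set
ProofTerm S = ProofTermUnder S zero

-- QEValidρ ρ A t  means  "the closed term t of A[ρ] is qE-valid", where
-- A[ρ] = renF ρ A.  The extra renaming ρ only makes the recursion on A
-- structural: clause (3) instantiates the ∀-body with Y by extending ρ.

_∷ρ_ : ℕ → (ℕ → ℕ) → ℕ → ℕ
(Y ∷ρ ρ) zero    = Y
(Y ∷ρ ρ) (suc i) = ρ i

QEValidρ : (ℕ → ℕ) → Formula → Term → Set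
QEValidρ ρ (atom X) t = ∃ λ s → t ↠ s × Normal s × ([] ⊢ s ∶ atom (ρ X))
QEValidρ ρ (B ⇒ C)  t = ∀ s → Closed s → QEValidρ ρ B s → QEValidρ ρ C (app t s)
QEValidρ ρ (all A)  t = ∀ (Y : ℕ) → QEValidρ (Y ∷ρ ρ) A (tapp t Y)

QEValidClosed : Formula → Term → Set
QEValidClosed A t = QEValidρ (λ i → i) A t

QEValid : List Formula → Term → Formula → Set
QEValid Γ t A =
  ∀ (σ : ℕ → Term) →
  (∀ {i B} → Γ ∋ i ∶ B → Closed (σ i) × QEValidClosed B (σ i)) →
  QEValidClosed A (sub σ t)

EValid : AtomicBase → List Formula → Term → Formula → Set
EValid S Γ t A = ProofTerm S t × QEValid Γ t A

-- Substituting the constant c^Aᵢ for each xᵢ turns t into a closed term, and this term is qE-valid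
-- because every constant is: a closed term reducing to a typed normal neutral term is qE-valid
-- (reflect). Conversely every qE-valid closed term reduces to a typed normal term (reify): at B ⇒ C
-- apply it to c^B, at ∀X.A instantiate X by an atom fresh for the term and the formula, so that the
-- instantiation can be undone. Constants and variables create no redexes, so the reduction, the
-- normality and the typing of the normal form lift back along the substitution, where c^Aᵢ has
-- exactly the type Aᵢ. Being a proof-term is stable under reduction.

module Submission where

open import Defs
open import Data.Empty using (⊥-elim)
open import Data.List using (List; []; _∷_; map; length)
open import Data.List.Properties using (map-∘; map-cong)
open import Data.Nat using (ℕ; zero; suc; _<_; _≤_; _∸_; _⊔_; pred; z≤n; s≤s; _≟_)
open import Data.Nat.Properties using (≤-refl; <-≤-trans; <-irrefl; m≤m⊔n; m≤n⊔m)
open import Data.Product using (_×_; _,_; proj₁; proj₂; ∃)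
open import Data.Sum using (_⊎_; inj₁; inj₂)
open import Data.Unit using (⊤; tt)
open import Function using (_∘_; id)
open import Relation.Binary.Definitions using (_Respects_)
open import Relation.Binary.PropositionalEquality
  using (_≡_; refl; sym; trans; cong; cong₂; subst; subst₂; _≗_; module ≡-Reasoning)
open import Relation.Binary.Construct.Closure.ReflexiveTransitive using (ε; _◅_; _◅◅_; gmap; fold)
open import Relation.Nullary using (¬_; yes; no)

private variable
  i k Y : ℕ
  ρ ρ' τ τ' : ℕ → ℕ
  σ σ' : ℕ → Term
  A B T : Formula
  Γ Δ : List Formula
  t u N : Term

-- Renaming and substitution

ext-∘ : ρ ∘ ρ' ≗ τ → ext ρ ∘ ext ρ' ≗ ext τ
ext-∘ e zero    = refl
ext-∘ e (suc i) = cong suc (e i)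

ext-id : ρ ≗ id → ext ρ ≗ id
ext-id e zero    = refl
ext-id e (suc i) = cong suc (e i)

renF-∘ : ρ ∘ ρ' ≗ τ → ∀ A → renF ρ (renF ρ' A) ≡ renF τ A
renF-∘ e (atom X) = cong atom (e X)
renF-∘ e (A ⇒ B)  = cong₂ _⇒_ (renF-∘ e A) (renF-∘ e B)
renF-∘ e (all A)  = cong all (renF-∘ (ext-∘ e) A)

renF-id : ρ ≗ id → ∀ A → renF ρ A ≡ A
renF-id e (atom X) = cong atom (e X)
renF-id e (A ⇒ B)  = cong₂ _⇒_ (renF-id e A) (renF-id e B)
renF-id e (all A)  = cong all (renF-id (ext-id e) A)

renF-square : ρ ∘ ρ' ≗ τ ∘ τ' → ∀ A → renF ρ (renF ρ' A) ≡ renF τ (renF τ' A)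
renF-square e A = trans (renF-∘ e A) (sym (renF-∘ (λ _ → refl) A))

renTT-∘ : ρ ∘ ρ' ≗ τ → ∀ t → renTT ρ (renTT ρ' t) ≡ renTT τ t
renTT-∘ e (var i)    = refl
renTT-∘ e (con A)    = cong con (renF-∘ e A)
renTT-∘ e (lam t)    = cong lam (renTT-∘ e t)
renTT-∘ e (app t s)  = cong₂ app (renTT-∘ e t) (renTT-∘ e s)
renTT-∘ e (tlam t)   = cong tlam (renTT-∘ (ext-∘ e) t)
renTT-∘ e (tapp t Y) = cong₂ tapp (renTT-∘ e t) (e Y)

renTT-id : ρ ≗ id → ∀ t → renTT ρ t ≡ t
renTT-id e (var i)    = refl
renTT-id e (con A)    = cong con (renF-id e A)
renTT-id e (lam t)    = cong lam (renTT-id e t)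
renTT-id e (app t s)  = cong₂ app (renTT-id e t) (renTT-id e s)
renTT-id e (tlam t)   = cong tlam (renTT-id (ext-id e) t)
renTT-id e (tapp t Y) = cong₂ tapp (renTT-id e t) (e Y)

renTT-square : ρ ∘ ρ' ≗ τ ∘ τ' → ∀ t → renTT ρ (renTT ρ' t) ≡ renTT τ (renTT τ' t)
renTT-square e t = trans (renTT-∘ e t) (sym (renTT-∘ (λ _ → refl) t))

renT-∘ : ρ ∘ ρ' ≗ τ → ∀ t → renT ρ (renT ρ' t) ≡ renT τ t
renT-∘ e (var i)    = cong var (e i)
renT-∘ e (con A)    = refl
renT-∘ e (lam t)    = cong lam (renT-∘ (ext-∘ e) t)
renT-∘ e (app t s)  = cong₂ app (renT-∘ e t) (renT-∘ e s)
renT-∘ e (tlam t)   = cong tlam (renT-∘ e t)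
renT-∘ e (tapp t Y) = cong₂ tapp (renT-∘ e t) refl

renT-square : ρ ∘ ρ' ≗ τ ∘ τ' → ∀ t → renT ρ (renT ρ' t) ≡ renT τ (renT τ' t)
renT-square e t = trans (renT-∘ e t) (sym (renT-∘ (λ _ → refl) t))

renTT-renT : ∀ ρ ρ' t → renTT ρ (renT ρ' t) ≡ renT ρ' (renTT ρ t)
renTT-renT ρ ρ' (var i)    = refl
renTT-renT ρ ρ' (con A)    = refl
renTT-renT ρ ρ' (lam t)    = cong lam (renTT-renT ρ (ext ρ') t)
renTT-renT ρ ρ' (app t s)  = cong₂ app (renTT-renT ρ ρ' t) (renTT-renT ρ ρ' s)
renTT-renT ρ ρ' (tlam t)   = cong tlam (renTT-renT (ext ρ) ρ' t)
renTT-renT ρ ρ' (tapp t Y) = cong₂ tapp (renTT-renT ρ ρ' t) refl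

sub-cong : σ ≗ σ' → ∀ t → sub σ t ≡ sub σ' t
sub-cong e (var i)    = e i
sub-cong e (con A)    = refl
sub-cong e (lam t)    = cong lam (sub-cong exts-cong t)
  where
  exts-cong : exts _ ≗ exts _
  exts-cong zero    = refl
  exts-cong (suc i) = cong (renT suc) (e i)
sub-cong e (app t s)  = cong₂ app (sub-cong e t) (sub-cong e s)
sub-cong e (tlam t)   = cong tlam (sub-cong (cong (renTT suc) ∘ e) t)
sub-cong e (tapp t Y) = cong₂ tapp (sub-cong e t) refl

sub-var : ∀ t → sub var t ≡ t
sub-var (var i)    = refl
sub-var (con A)    = refl
sub-var (lam t)    = cong lam (trans (sub-cong exts-var t) (sub-var t))
  where
  exts-var : exts var ≗ var
  exts-var zero    = refl
  exts-var (suc i) = refl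
sub-var (app t s)  = cong₂ app (sub-var t) (sub-var s)
sub-var (tlam t)   = cong tlam (sub-var t)
sub-var (tapp t Y) = cong₂ tapp (sub-var t) refl

renTT-sub : ∀ ρ σ t → renTT ρ (sub σ t) ≡ sub (renTT ρ ∘ σ) (renTT ρ t)
renTT-sub ρ σ (var i)    = refl
renTT-sub ρ σ (con A)    = refl
renTT-sub ρ σ (lam t)    = cong lam (trans (renTT-sub ρ (exts σ) t) (sub-cong renTT-exts (renTT ρ t)))
  where
  renTT-exts : renTT ρ ∘ exts σ ≗ exts (renTT ρ ∘ σ)
  renTT-exts zero    = refl
  renTT-exts (suc i) = renTT-renT ρ suc (σ i)
renTT-sub ρ σ (app t s)  = cong₂ app (renTT-sub ρ σ t) (renTT-sub ρ σ s)
renTT-sub ρ σ (tlam t)   =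
  cong tlam (trans (renTT-sub (ext ρ) (extsT σ) t)
                   (sub-cong (renTT-square (λ _ → refl) ∘ σ) (renTT (ext ρ) t)))
renTT-sub ρ σ (tapp t Y) = cong₂ tapp (renTT-sub ρ σ t) refl

sub-renT : ∀ σ ρ t → sub σ (renT ρ t) ≡ sub (σ ∘ ρ) t
sub-renT σ ρ (var i)    = refl
sub-renT σ ρ (con A)    = refl
sub-renT σ ρ (lam t)    = cong lam (trans (sub-renT (exts σ) (ext ρ) t) (sub-cong exts-ext t))
  where
  exts-ext : exts σ ∘ ext ρ ≗ exts (σ ∘ ρ)
  exts-ext zero    = refl
  exts-ext (suc i) = refl
sub-renT σ ρ (app t s)  = cong₂ app (sub-renT σ ρ t) (sub-renT σ ρ s)
sub-renT σ ρ (tlam t)   = cong tlam (sub-renT (extsT σ) ρ t)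
sub-renT σ ρ (tapp t Y) = cong₂ tapp (sub-renT σ ρ t) refl

renT-sub : ∀ ρ σ t → renT ρ (sub σ t) ≡ sub (renT ρ ∘ σ) t
renT-sub ρ σ (var i)    = refl
renT-sub ρ σ (con A)    = refl
renT-sub ρ σ (lam t)    = cong lam (trans (renT-sub (ext ρ) (exts σ) t) (sub-cong renT-exts t))
  where
  renT-exts : renT (ext ρ) ∘ exts σ ≗ exts (renT ρ ∘ σ)
  renT-exts zero    = refl
  renT-exts (suc i) = renT-square (λ _ → refl) (σ i)
renT-sub ρ σ (app t s)  = cong₂ app (renT-sub ρ σ t) (renT-sub ρ σ s)
renT-sub ρ σ (tlam t)   =
  cong tlam (trans (renT-sub ρ (extsT σ) t) (sub-cong (sym ∘ renTT-renT suc ρ ∘ σ) t))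
renT-sub ρ σ (tapp t Y) = cong₂ tapp (renT-sub ρ σ t) refl

sub-∘ : ∀ σ σ' t → sub σ (sub σ' t) ≡ sub (sub σ ∘ σ') t
sub-∘ σ σ' (var i)    = refl
sub-∘ σ σ' (con A)    = refl
sub-∘ σ σ' (lam t)    = cong lam (trans (sub-∘ (exts σ) (exts σ') t) (sub-cong sub-exts t))
  where
  sub-exts : sub (exts σ) ∘ exts σ' ≗ exts (sub σ ∘ σ')
  sub-exts zero    = refl
  sub-exts (suc i) = trans (sub-renT (exts σ) suc (σ' i)) (sym (renT-sub suc σ (σ' i)))
sub-∘ σ σ' (app t s)  = cong₂ app (sub-∘ σ σ' t) (sub-∘ σ σ' s)
sub-∘ σ σ' (tlam t)   =
  cong tlam (trans (sub-∘ (extsT σ) (extsT σ') t) (sub-cong (sym ∘ renTT-sub suc σ ∘ σ') t))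
sub-∘ σ σ' (tapp t Y) = cong₂ tapp (sub-∘ σ σ' t) refl

sub-[x≔] : ∀ σ w v → sub σ (w [x≔ v ]) ≡ sub (exts σ) w [x≔ sub σ v ]
sub-[x≔] σ w v = begin
  sub σ (w [x≔ v ])                          ≡⟨ sub-∘ σ (v ∷σ var) w ⟩
  sub (sub σ ∘ (v ∷σ var)) w                 ≡⟨ sub-cong pointwise w ⟩
  sub (sub (sub σ v ∷σ var) ∘ exts σ) w      ≡⟨ sub-∘ (sub σ v ∷σ var) (exts σ) w ⟨
  sub (exts σ) w [x≔ sub σ v ]               ∎
  where
  open ≡-Reasoning
  pointwise : sub σ ∘ (v ∷σ var) ≗ sub (sub σ v ∷σ var) ∘ exts σ
  pointwise zero    = refl
  pointwise (suc i) = sym (trans (sub-renT (sub σ v ∷σ var) suc (σ i)) (sub-var (σ i)))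

sub-inst : ∀ σ w Y → sub σ (renTT (inst Y) w) ≡ renTT (inst Y) (sub (extsT σ) w)
sub-inst σ w Y =
  sym (trans (renTT-sub (inst Y) (extsT σ) w) (sub-cong (renTT-inst-suc ∘ σ) (renTT (inst Y) w)))
  where
  renTT-inst-suc : ∀ u → renTT (inst Y) (renTT suc u) ≡ u
  renTT-inst-suc u = trans (renTT-∘ (λ _ → refl) u) (renTT-id (λ _ → refl) u)

renTT-[x≔] : ∀ ρ w v → renTT ρ (w [x≔ v ]) ≡ renTT ρ w [x≔ renTT ρ v ]
renTT-[x≔] ρ w v = trans (renTT-sub ρ (v ∷σ var) w) (sub-cong renTT-∷σ (renTT ρ w))
  where
  renTT-∷σ : renTT ρ ∘ (v ∷σ var) ≗ renTT ρ v ∷σ var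
  renTT-∷σ zero    = refl
  renTT-∷σ (suc i) = refl

renTT-inst : ∀ ρ w Y → renTT ρ (renTT (inst Y) w) ≡ renTT (inst (ρ Y)) (renTT (ext ρ) w)
renTT-inst ρ w Y = renTT-square ρ∘inst w
  where
  ρ∘inst : ρ ∘ inst Y ≗ inst (ρ Y) ∘ ext ρ
  ρ∘inst zero    = refl
  ρ∘inst (suc i) = refl

[0≔]-ext : ∀ ρ Y A → renF (ext ρ) A [0≔ Y ] ≡ renF (Y ∷ρ ρ) A
[0≔]-ext ρ Y = renF-∘ inst∘ext
  where
  inst∘ext : inst Y ∘ ext ρ ≗ Y ∷ρ ρ
  inst∘ext zero    = refl
  inst∘ext (suc i) = refl

-- Inert substitutions

data Inert : Term → Set where
  var : ∀ i → Inert (var i)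
  con : ∀ A → Inert (con A)

InertSub : (ℕ → Term) → Set
InertSub σ = ∀ i → Inert (σ i)

renT-inert : Inert u → Inert (renT ρ u)
renT-inert (var i) = var _
renT-inert (con A) = con A

renTT-inert : Inert u → Inert (renTT ρ u)
renTT-inert (var i) = var i
renTT-inert (con A) = con _

exts-inert : InertSub σ → InertSub (exts σ)
exts-inert ι zero    = var zero
exts-inert ι (suc i) = renT-inert (ι i)

extsT-inert : InertSub σ → InertSub (extsT σ)
extsT-inert ι i = renTT-inert (ι i)

inert-irreducible : Inert u → ¬ (u ⟶β N)
inert-irreducible (var i) ()
inert-irreducible (con A) ()

app-inert-⟶β : ∀ {f s} → Inert f → app f s ⟶β N → ∃ λ s' → s ⟶β s' × N ≡ app f s'
app-inert-⟶β ι (ξappL f⟶) = ⊥-elim (inert-irreducible ι f⟶)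
app-inert-⟶β ι (ξappR s⟶) = _ , s⟶ , refl

tapp-inert-irreducible : ∀ {f} → Inert f → ¬ (tapp f Y ⟶β N)
tapp-inert-irreducible ι (ξtapp f⟶) = inert-irreducible ι f⟶

sub-reflects-⟶β : InertSub σ → ∀ u → sub σ u ⟶β N → ∃ λ u' → u ⟶β u' × sub σ u' ≡ N
sub-reflects-⟶β ι (var i) st = ⊥-elim (inert-irreducible (ι i) st)
sub-reflects-⟶β ι (lam u) (ξlam st) with sub-reflects-⟶β (exts-inert ι) u st
... | u' , u⟶ , refl = lam u' , ξlam u⟶ , refl
sub-reflects-⟶β ι (app (var i) v) st with app-inert-⟶β (ι i) st
... | _ , st' , refl with sub-reflects-⟶β ι v st'
...   | v' , v⟶ , refl = app (var i) v' , ξappR v⟶ , refl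
sub-reflects-⟶β {σ = σ} ι (app (lam w) v) β = w [x≔ v ] , β , sub-[x≔] σ w v
sub-reflects-⟶β ι (app u v) (ξappL st) with sub-reflects-⟶β ι u st
... | u' , u⟶ , refl = app u' v , ξappL u⟶ , refl
sub-reflects-⟶β ι (app u v) (ξappR st) with sub-reflects-⟶β ι v st
... | v' , v⟶ , refl = app u v' , ξappR v⟶ , refl
sub-reflects-⟶β ι (tlam u) (ξtlam st) with sub-reflects-⟶β (extsT-inert ι) u st
... | u' , u⟶ , refl = tlam u' , ξtlam u⟶ , refl
sub-reflects-⟶β ι (tapp (var i) Y) st = ⊥-elim (tapp-inert-irreducible (ι i) st)
sub-reflects-⟶β {σ = σ} ι (tapp (tlam w) Y) βT = renTT (inst Y) w , βT , sub-inst σ w Y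
sub-reflects-⟶β ι (tapp u Y) (ξtapp st) with sub-reflects-⟶β ι u st
... | u' , u⟶ , refl = tapp u' Y , ξtapp u⟶ , refl

sub-reflects-↠ : InertSub σ → ∀ u → sub σ u ↠ N → ∃ λ u' → u ↠ u' × sub σ u' ≡ N
sub-reflects-↠ ι u ε = u , ε , refl
sub-reflects-↠ ι u (st ◅ rest) with sub-reflects-⟶β ι u st
... | u₁ , u⟶u₁ , refl with sub-reflects-↠ ι u₁ rest
...   | u' , u₁↠u' , eq = u' , u⟶u₁ ◅ u₁↠u' , eq

renTT-reflects-⟶β : ∀ ρ u → renTT ρ u ⟶β N → ∃ λ u' → u ⟶β u' × renTT ρ u' ≡ N
renTT-reflects-⟶β ρ (lam u) (ξlam st) with renTT-reflects-⟶β ρ u st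
... | u' , u⟶ , refl = lam u' , ξlam u⟶ , refl
renTT-reflects-⟶β ρ (app (lam w) v) β = w [x≔ v ] , β , renTT-[x≔] ρ w v
renTT-reflects-⟶β ρ (app u v) (ξappL st) with renTT-reflects-⟶β ρ u st
... | u' , u⟶ , refl = app u' v , ξappL u⟶ , refl
renTT-reflects-⟶β ρ (app u v) (ξappR st) with renTT-reflects-⟶β ρ v st
... | v' , v⟶ , refl = app u v' , ξappR v⟶ , refl
renTT-reflects-⟶β ρ (tlam u) (ξtlam st) with renTT-reflects-⟶β (ext ρ) u st
... | u' , u⟶ , refl = tlam u' , ξtlam u⟶ , refl
renTT-reflects-⟶β ρ (tapp (tlam w) Y) βT = renTT (inst Y) w , βT , renTT-inst ρ w Y
renTT-reflects-⟶β ρ (tapp u Y) (ξtapp st) with renTT-reflects-⟶β ρ u st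
... | u' , u⟶ , refl = tapp u' Y , ξtapp u⟶ , refl

renTT-reflects-↠ : ∀ ρ u → renTT ρ u ↠ N → ∃ λ u' → u ↠ u' × renTT ρ u' ≡ N
renTT-reflects-↠ ρ u ε = u , ε , refl
renTT-reflects-↠ ρ u (st ◅ rest) with renTT-reflects-⟶β ρ u st
... | u₁ , u⟶u₁ , refl with renTT-reflects-↠ ρ u₁ rest
...   | u' , u₁↠u' , eq = u' , u⟶u₁ ◅ u₁↠u' , eq

sub-reflects-Normal : ∀ σ u → Normal (sub σ u) → Normal u
sub-reflects-Normal σ (var i)    _            = tt
sub-reflects-Normal σ (con A)    _            = tt
sub-reflects-Normal σ (lam u)    nf           = sub-reflects-Normal (exts σ) u nf
sub-reflects-Normal σ (app u v)  (nl , nu , nv) =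
  notLam u nl , sub-reflects-Normal σ u nu , sub-reflects-Normal σ v nv
  where
  notLam : ∀ u → NotLam (sub σ u) → NotLam u
  notLam (lam _)    ()
  notLam (var _)    _ = tt
  notLam (con _)    _ = tt
  notLam (app _ _)  _ = tt
  notLam (tlam _)   _ = tt
  notLam (tapp _ _) _ = tt
sub-reflects-Normal σ (tlam u)   nf           = sub-reflects-Normal (extsT σ) u nf
sub-reflects-Normal σ (tapp u Y) (nt , nu)    = notTlam u nt , sub-reflects-Normal σ u nu
  where
  notTlam : ∀ u → NotTlam (sub σ u) → NotTlam u
  notTlam (tlam _)   ()
  notTlam (var _)    _ = tt
  notTlam (con _)    _ = tt
  notTlam (lam _)    _ = tt
  notTlam (app _ _)  _ = tt
  notTlam (tapp _ _) _ = tt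

renTT-reflects-Normal : ∀ ρ u → Normal (renTT ρ u) → Normal u
renTT-reflects-Normal ρ (var i)    _              = tt
renTT-reflects-Normal ρ (con A)    _              = tt
renTT-reflects-Normal ρ (lam u)    nf             = renTT-reflects-Normal ρ u nf
renTT-reflects-Normal ρ (app u v)  (nl , nu , nv) =
  notLam u nl , renTT-reflects-Normal ρ u nu , renTT-reflects-Normal ρ v nv
  where
  notLam : ∀ u → NotLam (renTT ρ u) → NotLam u
  notLam (lam _)    ()
  notLam (var _)    _ = tt
  notLam (con _)    _ = tt
  notLam (app _ _)  _ = tt
  notLam (tlam _)   _ = tt
  notLam (tapp _ _) _ = tt
renTT-reflects-Normal ρ (tlam u)   nf             = renTT-reflects-Normal (ext ρ) u nf
renTT-reflects-Normal ρ (tapp u Y) (nt , nu)      = notTlam u nt , renTT-reflects-Normal ρ u nu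
  where
  notTlam : ∀ u → NotTlam (renTT ρ u) → NotTlam u
  notTlam (tlam _)   ()
  notTlam (var _)    _ = tt
  notTlam (con _)    _ = tt
  notTlam (lam _)    _ = tt
  notTlam (app _ _)  _ = tt
  notTlam (tapp _ _) _ = tt

-- Proof-terms

↠-respects : ∀ {P : Term → Set} → P Respects _⟶β_ → P Respects _↠_
↠-respects {P} resp = fold (λ t t' → P t → P t') (λ st k → k ∘ resp st) id

KeepsFreeAtoms : ℕ → ℕ → (ℕ → ℕ) → Set
KeepsFreeAtoms k k' ρ = ∀ X → k ≤ X → k' ≤ ρ X × ρ X ∸ k' ≡ X ∸ k

ext-keepsFreeAtoms : ∀ {k k'} → KeepsFreeAtoms k k' ρ → KeepsFreeAtoms (suc k) (suc k') (ext ρ)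
ext-keepsFreeAtoms keeps (suc X) (s≤s k≤X) = s≤s (proj₁ (keeps X k≤X)) , proj₂ (keeps X k≤X)

suc-keepsFreeAtoms : KeepsFreeAtoms k (suc k) suc
suc-keepsFreeAtoms X k≤X = s≤s k≤X , refl

inst-keepsFreeAtoms : KeepsFreeAtoms (suc k) k (inst Y)
inst-keepsFreeAtoms (suc X) (s≤s k≤X) = k≤X , refl

module _ (S : AtomicBase) where

  ProofTermUnder-renTT : ∀ {k k'} → KeepsFreeAtoms k k' ρ →
                         ∀ u → ProofTermUnder S k u → ProofTermUnder S k' (renTT ρ u)
  ProofTermUnder-renTT keeps (var i)        _          = tt
  ProofTermUnder-renTT keeps (con (atom X)) (k≤X , SX) =
    proj₁ (keeps X k≤X) , subst S (sym (proj₂ (keeps X k≤X))) SX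
  ProofTermUnder-renTT keeps (lam u)        pu         = ProofTermUnder-renTT keeps u pu
  ProofTermUnder-renTT keeps (app u v)      (pu , pv)  =
    ProofTermUnder-renTT keeps u pu , ProofTermUnder-renTT keeps v pv
  ProofTermUnder-renTT keeps (tlam u)       pu         = ProofTermUnder-renTT (ext-keepsFreeAtoms keeps) u pu
  ProofTermUnder-renTT keeps (tapp u Y)     pu         = ProofTermUnder-renTT keeps u pu

  ProofTermUnder-renT : ∀ ρ u → ProofTermUnder S k u → ProofTermUnder S k (renT ρ u)
  ProofTermUnder-renT ρ (var i)    _         = tt
  ProofTermUnder-renT ρ (con A)    pu        = pu
  ProofTermUnder-renT ρ (lam u)    pu        = ProofTermUnder-renT (ext ρ) u pu
  ProofTermUnder-renT ρ (app u v)  (pu , pv) = ProofTermUnder-renT ρ u pu , ProofTermUnder-renT ρ v pv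
  ProofTermUnder-renT ρ (tlam u)   pu        = ProofTermUnder-renT ρ u pu
  ProofTermUnder-renT ρ (tapp u Y) pu        = ProofTermUnder-renT ρ u pu

  ProofTermUnder-sub : (∀ i → ProofTermUnder S k (σ i)) →
                       ∀ u → ProofTermUnder S k u → ProofTermUnder S k (sub σ u)
  ProofTermUnder-sub pσ (var i)    _         = pσ i
  ProofTermUnder-sub pσ (con A)    pu        = pu
  ProofTermUnder-sub {σ = σ} pσ (lam u) pu = ProofTermUnder-sub pexts u pu
    where
    pexts : ∀ i → ProofTermUnder S _ (exts σ i)
    pexts zero    = tt
    pexts (suc i) = ProofTermUnder-renT suc (σ i) (pσ i)
  ProofTermUnder-sub pσ (app u v)  (pu , pv) = ProofTermUnder-sub pσ u pu , ProofTermUnder-sub pσ v pv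
  ProofTermUnder-sub {σ = σ} pσ (tlam u) pu =
    ProofTermUnder-sub (λ i → ProofTermUnder-renTT suc-keepsFreeAtoms (σ i) (pσ i)) u pu
  ProofTermUnder-sub pσ (tapp u Y) pu        = ProofTermUnder-sub pσ u pu

  ProofTermUnder-⟶β : ∀ k → ProofTermUnder S k Respects _⟶β_
  ProofTermUnder-⟶β k (β {t} {s}) (pt , ps) = ProofTermUnder-sub ps∷var t pt
    where
    ps∷var : ∀ i → ProofTermUnder S k ((s ∷σ var) i)
    ps∷var zero    = ps
    ps∷var (suc i) = tt
  ProofTermUnder-⟶β k (βT {t})  pt        = ProofTermUnder-renTT inst-keepsFreeAtoms t pt
  ProofTermUnder-⟶β k (ξlam st)  pt       = ProofTermUnder-⟶β k st pt
  ProofTermUnder-⟶β k (ξappL st) (pt , ps) = ProofTermUnder-⟶β k st pt , ps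
  ProofTermUnder-⟶β k (ξappR st) (pt , ps) = pt , ProofTermUnder-⟶β k st ps
  ProofTermUnder-⟶β k (ξtlam st) pt       = ProofTermUnder-⟶β (suc k) st pt
  ProofTermUnder-⟶β k (ξtapp st) pt       = ProofTermUnder-⟶β k st pt

  ProofTerm-↠ : ProofTerm S Respects _↠_
  ProofTerm-↠ = ↠-respects (ProofTermUnder-⟶β zero)

-- Atom bounds and fresh atoms

BoundedF : ℕ → Formula → Set
BoundedF k (atom X) = X < k
BoundedF k (A ⇒ B)  = BoundedF k A × BoundedF k B
BoundedF k (all A)  = BoundedF (suc k) A

Bounded : ℕ → Term → Set
Bounded k (var i)    = ⊤
Bounded k (con A)    = BoundedF k A
Bounded k (lam t)    = Bounded k t
Bounded k (app t s)  = Bounded k t × Bounded k s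
Bounded k (tlam t)   = Bounded (suc k) t
Bounded k (tapp t Y) = Bounded k t × Y < k

BoundedF-mono : ∀ {k k'} → k ≤ k' → ∀ A → BoundedF k A → BoundedF k' A
BoundedF-mono k≤k' (atom X) X<k     = <-≤-trans X<k k≤k'
BoundedF-mono k≤k' (A ⇒ B)  (bA , bB) = BoundedF-mono k≤k' A bA , BoundedF-mono k≤k' B bB
BoundedF-mono k≤k' (all A)  bA       = BoundedF-mono (s≤s k≤k') A bA

Bounded-mono : ∀ {k k'} → k ≤ k' → ∀ t → Bounded k t → Bounded k' t
Bounded-mono k≤k' (var i)    _         = tt
Bounded-mono k≤k' (con A)    bA        = BoundedF-mono k≤k' A bA
Bounded-mono k≤k' (lam t)    bt        = Bounded-mono k≤k' t bt
Bounded-mono k≤k' (app t s)  (bt , bs) = Bounded-mono k≤k' t bt , Bounded-mono k≤k' s bs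
Bounded-mono k≤k' (tlam t)   bt        = Bounded-mono (s≤s k≤k') t bt
Bounded-mono k≤k' (tapp t Y) (bt , Y<k) = Bounded-mono k≤k' t bt , <-≤-trans Y<k k≤k'

atomBoundF : Formula → ℕ
atomBoundF (atom X) = suc X
atomBoundF (A ⇒ B)  = atomBoundF A ⊔ atomBoundF B
atomBoundF (all A)  = pred (atomBoundF A)

atomBound : Term → ℕ
atomBound (var i)    = zero
atomBound (con A)    = atomBoundF A
atomBound (lam t)    = atomBound t
atomBound (app t s)  = atomBound t ⊔ atomBound s
atomBound (tlam t)   = pred (atomBound t)
atomBound (tapp t Y) = atomBound t ⊔ suc Y

private
  n≤suc-pred : ∀ n → n ≤ suc (pred n)
  n≤suc-pred zero    = z≤n
  n≤suc-pred (suc n) = ≤-refl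

BoundedF-atomBoundF : ∀ A → BoundedF (atomBoundF A) A
BoundedF-atomBoundF (atom X) = ≤-refl
BoundedF-atomBoundF (A ⇒ B)  =
  BoundedF-mono (m≤m⊔n _ _) A (BoundedF-atomBoundF A) , BoundedF-mono (m≤n⊔m _ _) B (BoundedF-atomBoundF B)
BoundedF-atomBoundF (all A)  = BoundedF-mono (n≤suc-pred _) A (BoundedF-atomBoundF A)

Bounded-atomBound : ∀ t → Bounded (atomBound t) t
Bounded-atomBound (var i)    = tt
Bounded-atomBound (con A)    = BoundedF-atomBoundF A
Bounded-atomBound (lam t)    = Bounded-atomBound t
Bounded-atomBound (app t s)  =
  Bounded-mono (m≤m⊔n _ _) t (Bounded-atomBound t) , Bounded-mono (m≤n⊔m _ _) s (Bounded-atomBound s)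
Bounded-atomBound (tlam t)   = Bounded-mono (n≤suc-pred _) t (Bounded-atomBound t)
Bounded-atomBound (tapp t Y) = Bounded-mono (m≤m⊔n _ _) t (Bounded-atomBound t) , m≤n⊔m _ _

fresh : Term → Formula → ℕ
fresh t A = atomBound t ⊔ atomBoundF A

Bounded-fresh : ∀ t A → Bounded (fresh t A) t
Bounded-fresh t A = Bounded-mono (m≤m⊔n _ _) t (Bounded-atomBound t)

BoundedF-fresh : ∀ t A → BoundedF (fresh t A) A
BoundedF-fresh t A = BoundedF-mono (m≤n⊔m _ _) A (BoundedF-atomBoundF A)

MapsBelow : ℕ → ℕ → (ℕ → ℕ) → Set
MapsBelow k k' ρ = ∀ {i} → i < k → ρ i < k'

ext-mapsBelow : ∀ {k k'} → MapsBelow k k' ρ → MapsBelow (suc k) (suc k') (ext ρ)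
ext-mapsBelow maps {zero}  _         = s≤s z≤n
ext-mapsBelow maps {suc i} (s≤s i<k) = s≤s (maps i<k)

inst-mapsBelow : Y < k → MapsBelow (suc k) k (inst Y)
inst-mapsBelow Y<k {zero}  _         = Y<k
inst-mapsBelow Y<k {suc i} (s≤s i<k) = i<k

BoundedF-renF : ∀ {k k'} → MapsBelow k k' ρ → ∀ A → BoundedF k A → BoundedF k' (renF ρ A)
BoundedF-renF maps (atom X) X<k      = maps X<k
BoundedF-renF maps (A ⇒ B)  (bA , bB) = BoundedF-renF maps A bA , BoundedF-renF maps B bB
BoundedF-renF maps (all A)  bA       = BoundedF-renF (ext-mapsBelow maps) A bA

Bounded-renTT : ∀ {k k'} → MapsBelow k k' ρ → ∀ t → Bounded k t → Bounded k' (renTT ρ t)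
Bounded-renTT maps (var i)    _          = tt
Bounded-renTT maps (con A)    bA         = BoundedF-renF maps A bA
Bounded-renTT maps (lam t)    bt         = Bounded-renTT maps t bt
Bounded-renTT maps (app t s)  (bt , bs)  = Bounded-renTT maps t bt , Bounded-renTT maps s bs
Bounded-renTT maps (tlam t)   bt         = Bounded-renTT (ext-mapsBelow maps) t bt
Bounded-renTT maps (tapp t Y) (bt , Y<k) = Bounded-renTT maps t bt , maps Y<k

Bounded-renT : ∀ ρ t → Bounded k t → Bounded k (renT ρ t)
Bounded-renT ρ (var i)    _          = tt
Bounded-renT ρ (con A)    bA         = bA
Bounded-renT ρ (lam t)    bt         = Bounded-renT (ext ρ) t bt
Bounded-renT ρ (app t s)  (bt , bs)  = Bounded-renT ρ t bt , Bounded-renT ρ s bs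
Bounded-renT ρ (tlam t)   bt         = Bounded-renT ρ t bt
Bounded-renT ρ (tapp t Y) (bt , Y<k) = Bounded-renT ρ t bt , Y<k

Bounded-sub : (∀ i → Bounded k (σ i)) → ∀ t → Bounded k t → Bounded k (sub σ t)
Bounded-sub bσ (var i)    _          = bσ i
Bounded-sub bσ (con A)    bA         = bA
Bounded-sub {σ = σ} bσ (lam t) bt    = Bounded-sub bexts t bt
  where
  bexts : ∀ i → Bounded _ (exts σ i)
  bexts zero    = tt
  bexts (suc i) = Bounded-renT suc (σ i) (bσ i)
Bounded-sub bσ (app t s)  (bt , bs)  = Bounded-sub bσ t bt , Bounded-sub bσ s bs
Bounded-sub {σ = σ} bσ (tlam t) bt   = Bounded-sub (λ i → Bounded-renTT s≤s (σ i) (bσ i)) t bt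
Bounded-sub bσ (tapp t Y) (bt , Y<k) = Bounded-sub bσ t bt , Y<k

Bounded-⟶β : ∀ k → Bounded k Respects _⟶β_
Bounded-⟶β k (β {t} {s}) (bt , bs) = Bounded-sub bs∷var t bt
  where
  bs∷var : ∀ i → Bounded k ((s ∷σ var) i)
  bs∷var zero    = bs
  bs∷var (suc i) = tt
Bounded-⟶β k (βT {t}) (bt , Y<k)    = Bounded-renTT (inst-mapsBelow Y<k) t bt
Bounded-⟶β k (ξlam st)  bt          = Bounded-⟶β k st bt
Bounded-⟶β k (ξappL st) (bt , bs)   = Bounded-⟶β k st bt , bs
Bounded-⟶β k (ξappR st) (bt , bs)   = bt , Bounded-⟶β k st bs
Bounded-⟶β k (ξtlam st) bt          = Bounded-⟶β (suc k) st bt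
Bounded-⟶β k (ξtapp st) (bt , Y<k)  = Bounded-⟶β k st bt , Y<k

Bounded-↠ : ∀ k → Bounded k Respects _↠_
Bounded-↠ k = ↠-respects (Bounded-⟶β k)

uninst : ℕ → ℕ → ℕ
uninst k i with i ≟ k
... | yes _ = zero
... | no _  = suc i

uninst-inst : ∀ k {i} → i < suc k → uninst k (inst k i) ≡ i
uninst-inst k {zero} _ with k ≟ k
... | yes _   = refl
... | no k≢k = ⊥-elim (k≢k refl)
uninst-inst k {suc i} (s≤s i<k) with i ≟ k
... | yes refl = ⊥-elim (<-irrefl refl i<k)
... | no _     = refl

FixesBelow : ℕ → (ℕ → ℕ) → Set
FixesBelow k ρ = ∀ {i} → i < k → ρ i ≡ i

ext-fixesBelow : FixesBelow k ρ → FixesBelow (suc k) (ext ρ)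
ext-fixesBelow fixes {zero}  _         = refl
ext-fixesBelow fixes {suc i} (s≤s i<k) = cong suc (fixes i<k)

renF-fixesBelow : FixesBelow k ρ → ∀ A → BoundedF k A → renF ρ A ≡ A
renF-fixesBelow fixes (atom X) X<k      = cong atom (fixes X<k)
renF-fixesBelow fixes (A ⇒ B)  (bA , bB) =
  cong₂ _⇒_ (renF-fixesBelow fixes A bA) (renF-fixesBelow fixes B bB)
renF-fixesBelow fixes (all A)  bA       = cong all (renF-fixesBelow (ext-fixesBelow fixes) A bA)

renTT-fixesBelow : FixesBelow k ρ → ∀ t → Bounded k t → renTT ρ t ≡ t
renTT-fixesBelow fixes (var i)    _          = refl
renTT-fixesBelow fixes (con A)    bA         = cong con (renF-fixesBelow fixes A bA)
renTT-fixesBelow fixes (lam t)    bt         = cong lam (renTT-fixesBelow fixes t bt)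
renTT-fixesBelow fixes (app t s)  (bt , bs)  =
  cong₂ app (renTT-fixesBelow fixes t bt) (renTT-fixesBelow fixes s bs)
renTT-fixesBelow fixes (tlam t)   bt         = cong tlam (renTT-fixesBelow (ext-fixesBelow fixes) t bt)
renTT-fixesBelow fixes (tapp t Y) (bt , Y<k) = cong₂ tapp (renTT-fixesBelow fixes t bt) (fixes Y<k)

renF-uninst-inst : ∀ k A → BoundedF (suc k) A → renF (uninst k) (A [0≔ k ]) ≡ A
renF-uninst-inst k A bA = trans (renF-∘ (λ _ → refl) A) (renF-fixesBelow (uninst-inst k) A bA)

renTT-uninst-inst : ∀ k t → Bounded (suc k) t → renTT (uninst k) (renTT (inst k) t) ≡ t
renTT-uninst-inst k t bt = trans (renTT-∘ (λ _ → refl) t) (renTT-fixesBelow (uninst-inst k) t bt)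

[0≔fresh]-injective : ∀ k → BoundedF (suc k) A → BoundedF (suc k) B →
                      A [0≔ k ] ≡ B [0≔ k ] → A ≡ B
[0≔fresh]-injective {A} {B} k bA bB eq = begin
  A                            ≡⟨ renF-uninst-inst k A bA ⟨
  renF (uninst k) (A [0≔ k ])  ≡⟨ cong (renF (uninst k)) eq ⟩
  renF (uninst k) (B [0≔ k ])  ≡⟨ renF-uninst-inst k B bB ⟩
  B                            ∎
  where open ≡-Reasoning

-- Typing

∋-map : ∀ {f : Formula → Formula} → Γ ∋ i ∶ A → map f Γ ∋ i ∶ f A
∋-map here      = here
∋-map (there x) = there (∋-map x)

∋-map⁻¹ : ∀ {f : Formula → Formula} Γ → map f Γ ∋ i ∶ T → ∃ λ A → Γ ∋ i ∶ A × T ≡ f A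
∋-map⁻¹ (A ∷ Γ) here      = A , here , refl
∋-map⁻¹ (A ∷ Γ) (there x) with ∋-map⁻¹ Γ x
... | B , y , refl = B , there y , refl

⊢-renTT : ∀ ρ → Γ ⊢ t ∶ A → map (renF ρ) Γ ⊢ renTT ρ t ∶ renF ρ A
⊢-renTT ρ (⊢var x)    = ⊢var (∋-map x)
⊢-renTT ρ ⊢con        = ⊢con
⊢-renTT ρ (⊢lam d)    = ⊢lam (⊢-renTT ρ d)
⊢-renTT ρ (⊢app d e)  = ⊢app (⊢-renTT ρ d) (⊢-renTT ρ e)
⊢-renTT {Γ = Γ} ρ (⊢tlam d) = ⊢tlam (subst (_⊢ _ ∶ _) shifted-context (⊢-renTT (ext ρ) d))
  where
  shifted-context : map (renF (ext ρ)) (map (renF suc) Γ) ≡ map (renF suc) (map (renF ρ) Γ)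
  shifted-context = trans (sym (map-∘ Γ)) (trans (map-cong (renF-square (λ _ → refl)) Γ) (map-∘ Γ))
⊢-renTT ρ (⊢tapp {A = A} Y d) =
  subst (_ ⊢ _ ∶_) (renF-square ρ∘inst A) (⊢tapp (ρ Y) (⊢-renTT ρ d))
  where
  ρ∘inst : inst (ρ Y) ∘ ext ρ ≗ ρ ∘ inst Y
  ρ∘inst zero    = refl
  ρ∘inst (suc i) = refl

⊢tapp⁻¹ : ∀ {f} → Γ ⊢ tapp f Y ∶ T → ∃ λ A → Γ ⊢ f ∶ all A × T ≡ A [0≔ Y ]
⊢tapp⁻¹ (⊢tapp Y d) = _ , d , refl

renT-suc-reflects-⊢ : Inert u → (A ∷ Δ) ⊢ renT suc u ∶ T → Δ ⊢ u ∶ T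
renT-suc-reflects-⊢ (var j) (⊢var (there x)) = ⊢var x
renT-suc-reflects-⊢ (con B) ⊢con             = ⊢con

renTT-suc-reflects-⊢ : ∀ Δ → Inert u → map (renF suc) Δ ⊢ renTT suc u ∶ T →
                       ∃ λ T₀ → Δ ⊢ u ∶ T₀ × T ≡ renF suc T₀
renTT-suc-reflects-⊢ Δ (var j) (⊢var x) with ∋-map⁻¹ Δ x
... | T₀ , x₀ , refl = T₀ , ⊢var x₀ , refl
renTT-suc-reflects-⊢ Δ (con B) ⊢con = B , ⊢con , refl

TypeReflecting : (ℕ → Term) → List Formula → List Formula → Set
TypeReflecting σ Γ Δ = ∀ {i T} → Δ ⊢ σ i ∶ T → Γ ∋ i ∶ T

exts-typeReflecting : InertSub σ → TypeReflecting σ Γ Δ → TypeReflecting (exts σ) (A ∷ Γ) (A ∷ Δ)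
exts-typeReflecting ι reflects {zero}  (⊢var here) = here
exts-typeReflecting ι reflects {suc i} d           = there (reflects (renT-suc-reflects-⊢ (ι i) d))

extsT-typeReflecting : InertSub σ → TypeReflecting σ Γ Δ →
                       TypeReflecting (extsT σ) (map (renF suc) Γ) (map (renF suc) Δ)
extsT-typeReflecting {Δ = Δ} ι reflects {i} d with renTT-suc-reflects-⊢ Δ (ι i) d
... | T₀ , d₀ , refl = ∋-map (reflects d₀)

sub-reflects-⊢ : InertSub σ → TypeReflecting σ Γ Δ → ∀ u → Δ ⊢ sub σ u ∶ T → Γ ⊢ u ∶ T
sub-reflects-⊢ ι reflects (var i)    d           = ⊢var (reflects d)
sub-reflects-⊢ ι reflects (con A)    ⊢con        = ⊢con
sub-reflects-⊢ ι reflects (lam u)    (⊢lam d)    =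
  ⊢lam (sub-reflects-⊢ (exts-inert ι) (exts-typeReflecting ι reflects) u d)
sub-reflects-⊢ ι reflects (app u v)  (⊢app d e)  =
  ⊢app (sub-reflects-⊢ ι reflects u d) (sub-reflects-⊢ ι reflects v e)
sub-reflects-⊢ ι reflects (tlam u)   (⊢tlam d)   =
  ⊢tlam (sub-reflects-⊢ (extsT-inert ι) (extsT-typeReflecting ι reflects) u d)
sub-reflects-⊢ ι reflects (tapp u Y) (⊢tapp _ d) = ⊢tapp Y (sub-reflects-⊢ ι reflects u d)

-- Normal forms

Neutral : Term → Set
Neutral t = NotLam t × NotTlam t

⇒-NotTlam : ∀ f → Γ ⊢ f ∶ A ⇒ B → NotTlam f
⇒-NotTlam (tlam _)   ()
⇒-NotTlam (var _)    _ = tt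
⇒-NotTlam (con _)    _ = tt
⇒-NotTlam (lam _)    _ = tt
⇒-NotTlam (app _ _)  _ = tt
⇒-NotTlam (tapp _ _) _ = tt

all-NotLam : ∀ f → Γ ⊢ f ∶ all A → NotLam f
all-NotLam (lam _)    ()
all-NotLam (var _)    _ = tt
all-NotLam (con _)    _ = tt
all-NotLam (app _ _)  _ = tt
all-NotLam (tlam _)   _ = tt
all-NotLam (tapp _ _) _ = tt

-- A closed normal neutral term is a constant c^D applied to arguments, and D bounds its type.
neutral-type-bounded : ∀ n → Normal n → Neutral n → [] ⊢ n ∶ T → Bounded k n → BoundedF k T
neutral-type-bounded (var i)    _              _ (⊢var ())   _
neutral-type-bounded (con A)    _              _ ⊢con        bA = bA
neutral-type-bounded (app f s)  (nl , nf , _)  _ (⊢app d _)  (bf , _) =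
  proj₂ (neutral-type-bounded f nf (nl , ⇒-NotTlam f d) d bf)
neutral-type-bounded (tapp f Y) (nt , nf)      _ (⊢tapp {A = A} Y d) (bf , Y<k) =
  BoundedF-renF (inst-mapsBelow Y<k) A (neutral-type-bounded f nf (all-NotLam f d , nt) d bf)

infix 4 _⊢_⇓_
_⊢_⇓_ : List Formula → Term → Formula → Set
Γ ⊢ t ⇓ A = ∃ λ s → t ↠ s × Normal s × Γ ⊢ s ∶ A

constSub : List Formula → ℕ → Term
constSub []      = var
constSub (A ∷ Γ) = con A ∷σ constSub Γ

constSub-inert : ∀ Γ → InertSub (constSub Γ)
constSub-inert []      i       = var i
constSub-inert (A ∷ Γ) zero    = con A
constSub-inert (A ∷ Γ) (suc i) = constSub-inert Γ i

constSub-typeReflecting : ∀ Γ → TypeReflecting (constSub Γ) Γ []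
constSub-typeReflecting []      (⊢var ())
constSub-typeReflecting (A ∷ Γ) {zero}  ⊢con = here
constSub-typeReflecting (A ∷ Γ) {suc i} d    = there (constSub-typeReflecting Γ d)

constSub-reflects-⇓ : ∀ Γ t → [] ⊢ sub (constSub Γ) t ⇓ A → Γ ⊢ t ⇓ A
constSub-reflects-⇓ Γ t (_ , r , nf , d) with sub-reflects-↠ (constSub-inert Γ) t r
... | s , t↠s , refl =
  s , t↠s , sub-reflects-Normal (constSub Γ) s nf ,
  sub-reflects-⊢ (constSub-inert Γ) (constSub-typeReflecting Γ) s d

app-con-↠-cases : ∀ {f} → app f (con A) ↠ N →
  (∃ λ f' → f ↠ f' × N ≡ app f' (con A)) ⊎ (∃ λ u → f ↠ lam u × u [x≔ con A ] ↠ N)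
app-con-↠-cases ε                  = inj₁ (_ , ε , refl)
app-con-↠-cases (β ◅ rest)         = inj₂ (_ , ε , rest)
app-con-↠-cases (ξappR () ◅ _)
app-con-↠-cases (ξappL st ◅ rest) with app-con-↠-cases rest
... | inj₁ (f' , r , eq)  = inj₁ (f' , st ◅ r , eq)
... | inj₂ (u , r , r')   = inj₂ (u , st ◅ r , r')

tapp-↠-cases : ∀ {f} → tapp f Y ↠ N →
  (∃ λ f' → f ↠ f' × N ≡ tapp f' Y) ⊎ (∃ λ u → f ↠ tlam u × renTT (inst Y) u ↠ N)
tapp-↠-cases ε                  = inj₁ (_ , ε , refl)
tapp-↠-cases (βT ◅ rest)        = inj₂ (_ , ε , rest)
tapp-↠-cases (ξtapp st ◅ rest) with tapp-↠-cases rest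
... | inj₁ (f' , r , eq)  = inj₁ (f' , st ◅ r , eq)
... | inj₂ (u , r , r')   = inj₂ (u , st ◅ r , r')

lam-↠ : u ↠ N → lam u ↠ lam N
lam-↠ = gmap lam ξlam

tlam-↠ : u ↠ N → tlam u ↠ tlam N
tlam-↠ = gmap tlam ξtlam

app-↠ : ∀ {f f' s s'} → f ↠ f' → s ↠ s' → app f s ↠ app f' s'
app-↠ {f' = f'} {s = s} f↠ s↠ = gmap (λ f → app f s) ξappL f↠ ◅◅ gmap (app f') ξappR s↠

tapp-↠ : ∀ {f f'} → f ↠ f' → tapp f Y ↠ tapp f' Y
tapp-↠ {Y = Y} = gmap (λ f → tapp f Y) ξtapp

app-con-reflects-⇓ : ∀ t → [] ⊢ app t (con A) ⇓ B → [] ⊢ t ⇓ A ⇒ B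
app-con-reflects-⇓ {A} t (N , r , nf , d) with app-con-↠-cases r
... | inj₁ (t' , t↠t' , refl) with d
...   | ⊢app d' ⊢con = t' , t↠t' , proj₁ (proj₂ nf) , d'
app-con-reflects-⇓ {A} t (N , r , nf , d) | inj₂ (u , t↠lam , u[c]↠N)
  with constSub-reflects-⇓ (A ∷ []) u (N , u[c]↠N , nf , d)
... | u' , u↠u' , nf' , d' = lam u' , t↠lam ◅◅ lam-↠ u↠u' , nf' , ⊢lam d'

⊢-uninst : ∀ k → Bounded (suc k) u → BoundedF (suc k) A →
           [] ⊢ renTT (inst k) u ∶ A [0≔ k ] → [] ⊢ u ∶ A
⊢-uninst {u} {A} k bu bA d =
  subst₂ ([] ⊢_∶_) (renTT-uninst-inst k u bu) (renF-uninst-inst k A bA) (⊢-renTT (uninst k) d)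

tapp-fresh-reflects-⇓ : ∀ k t → Bounded k t → BoundedF (suc k) A →
                        [] ⊢ tapp t k ⇓ A [0≔ k ] → [] ⊢ t ⇓ all A
tapp-fresh-reflects-⇓ {A} k t bt bA (N , r , nf , d) with tapp-↠-cases r
... | inj₁ (t' , t↠t' , refl) with ⊢tapp⁻¹ d
...   | A' , d' , eq = t' , t↠t' , proj₂ nf , subst (λ B → [] ⊢ t' ∶ all B) A'≡A d'
  where
  bA' : BoundedF (suc k) A'
  bA' = neutral-type-bounded t' (proj₂ nf) (all-NotLam t' d' , proj₁ nf) d' (Bounded-↠ k t↠t' bt)
  A'≡A : A' ≡ A
  A'≡A = [0≔fresh]-injective k bA' bA (sym eq)
tapp-fresh-reflects-⇓ k t bt bA (N , r , nf , d) | inj₂ (u , t↠tlam , u[k]↠N)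
  with renTT-reflects-↠ (inst k) u u[k]↠N
... | u' , u↠u' , refl =
  tlam u' , t↠tlam' , renTT-reflects-Normal (inst k) u' nf , ⊢tlam (⊢-uninst k bu' bA d)
  where
  t↠tlam' : t ↠ tlam u'
  t↠tlam' = t↠tlam ◅◅ tlam-↠ u↠u'
  bu' : Bounded (suc k) u'
  bu' = Bounded-↠ k t↠tlam' bt

-- Reflection and reification

mutual
  reflect : ∀ ρ A → t ↠ N → Normal N → Neutral N → [] ⊢ N ∶ renF ρ A → QEValidρ ρ A t
  reflect ρ (atom X) t↠N nf _ d = _ , t↠N , nf , d
  reflect ρ (B ⇒ C) t↠N nf (nl , _) d s _ vs =
    let s' , s↠s' , nf' , d' = reify ρ B vs
    in  reflect ρ C (app-↠ t↠N s↠s') (nl , nf , nf') (tt , tt) (⊢app d d')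
  reflect ρ (all A) t↠N nf (_ , nt) d Y =
    reflect (Y ∷ρ ρ) A (tapp-↠ t↠N) (nt , nf) (tt , tt)
      (subst ([] ⊢ _ ∶_) ([0≔]-ext ρ Y A) (⊢tapp Y d))

  reify : ∀ ρ A → QEValidρ ρ A t → [] ⊢ t ⇓ renF ρ A
  reify ρ (atom X) v = v
  reify {t} ρ (B ⇒ C) v =
    app-con-reflects-⇓ t (reify ρ C (v (con (renF ρ B)) tt (reflect ρ B ε tt (tt , tt) ⊢con)))
  reify {t} ρ (all A) v =
    tapp-fresh-reflects-⇓ X₀ t (Bounded-fresh t ∀A) (BoundedF-fresh t ∀A)
      (subst ([] ⊢ tapp t X₀ ⇓_) (sym ([0≔]-ext ρ X₀ A)) (reify (X₀ ∷ρ ρ) A (v X₀)))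
    where
    ∀A = all (renF (ext ρ) A)
    X₀ = fresh t ∀A

reify-closed : ∀ A → QEValidClosed A t → [] ⊢ t ⇓ A
reify-closed A v = subst ([] ⊢ _ ⇓_) (renF-id (λ _ → refl) A) (reify id A v)

con-valid : ∀ A → QEValidClosed A (con A)
con-valid A = reflect id A ε tt (tt , tt) (subst ([] ⊢ con A ∶_) (sym (renF-id (λ _ → refl) A)) ⊢con)

constSub-valid : ∀ Γ {i A} → Γ ∋ i ∶ A → Closed (constSub Γ i) × QEValidClosed A (constSub Γ i)
constSub-valid (A ∷ Γ) here      = tt , con-valid A
constSub-valid (A ∷ Γ) (there x) = constSub-valid Γ x

mainTheorem5 : (S : AtomicBase) (A : Formula) (Γ : List Formula) (t : Term) →
    Scoped (length Γ) t →
    EValid S Γ t A →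
    ∃ λ s → (t ↠ s) × Normal s × ProofTerm S s × (Γ ⊢ s ∶ A)
mainTheorem5 S A Γ t _ (pt , qv) =
  let s , t↠s , nf , d = constSub-reflects-⇓ Γ t (reify-closed A (qv (constSub Γ) (constSub-valid Γ)))
  in  s , t↠s , nf , ProofTerm-↠ S t↠s pt , d
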